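{- Let $\sigma=(M_1,\dots,M_k)$ be a sequence of matroids on a common ground set $E$. Then the free sum of $\sigma$ is a multimatroid (in fact a $k$-matroid) if and only if the matroids $M_1,\dots,M_k$ are mutually orthogonal.
   Context: A carrier is $(U,\Omega)$ with $\Omega$ a partition of finite $U$ into skew classes; a skew pair is a 2-subset of a skew class; transversals meet each class in exactly one element, subtransversals are subsets of transversals. A semi-multimatroid $Z=(U,\Omega,\mathcal{C})$ has circuits $\mathcal{C}$ (subtransversals) such that each $(T,\mathcal{C}\cap 2^T)$, $T$ a transversal, is a matroid (by circuits); it is sheltered by a matroid $M$ on $U$ if for every transversal $T$ the circuits of $Z$ contained in $T$ are exactly the circuits of the restriction of $M$ to $T$. $Z$ is a multimatroid if no union of two circuits contains exactly one skew pair; a $k$-matroid is a multimatroid with all skew classes of size $k$. Free sum: for $i\in\{1,\dots,k\}$ let $\varphi_i(e)=(e,i)$; let $\omega_e=\{(e,i):1\le i\le k\}$, $\Omega=\{\omega_e:e\in E\}$, $U=\bigcup\Omega$; the free sum of $\sigma$ is the semi-multimatroid over $(U,\Omega)$ sheltered by the direct sum of the renamed matroids $\varphi_i(M_i)$. Matroids $M,M'$ on $E$ are orthogonal if $|C\cap C'|\ne 1$ for all circuits $C$ of $M$ and $C'$ of $M'$. -}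

module Defs where

open import Data.Nat using (ℕ; _*_)
open import Data.Fin using (Fin; remQuot; _≟_)
open import Data.Fin.Subset using (Subset; _∈_; _∉_; _⊆_; _∪_; _∩_; _-_; ∣_∣; ⊥)
open import Data.Vec using (tabulate)
open import Data.Bool using (Bool; true; false; _∧_)
open import Data.Product using (Σ; ∃; _×_; _,_; proj₁; proj₂)
open import Data.Sum using (_⊎_)
open import Relation.Nullary using (¬_)
open import Relation.Nullary.Decidable using (⌊_⌋)
open import Relation.Binary.PropositionalEquality using (_≡_; _≢_)
open import Level using (suc; zero)

-- Matroids given by circuits (Oxley's axioms C1–C3).
-- Ground set: a subset G of Fin m; circuits: a predicate on Subset m.

record IsMatroidOn {m : ℕ} (G : Subset m) (circuit : Subset m → Set) : Set where
  field
    within : ∀ C → circuit C → C ⊆ G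
    C1     : ¬ circuit ⊥
    C2     : ∀ C D → circuit C → circuit D → C ⊆ D → C ≡ D
    C3     : ∀ C D e → circuit C → circuit D → C ≢ D → e ∈ C → e ∈ D →
             ∃ λ F → circuit F × F ⊆ ((C ∪ D) - e)

record Matroid (n : ℕ) : Set₁ where
  field
    circuit  : Subset n → Set
    isMatroid : IsMatroidOn (tabulate (λ _ → true)) circuit
open Matroid public

Orthogonal : ∀ {n} → Matroid n → Matroid n → Set
Orthogonal M M' = ∀ C C' → circuit M C → circuit M' C' → ∣ C ∩ C' ∣ ≢ 1

MutuallyOrthogonal : ∀ {n k} → (Fin k → Matroid n) → Set
MutuallyOrthogonal {k = k} σ = (i j : Fin k) → i ≢ j → Orthogonal (σ i) (σ j)

-- Carriers: a finite set U = Fin m partitioned into skew classes,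
-- given by a class map cls : Fin m → Fin p (class of u is cls u).

module Carrier {m p : ℕ} (cls : Fin m → Fin p) where

  Transversal : Subset m → Set
  Transversal T = (j : Fin p) → ∃ λ u → u ∈ T × cls u ≡ j ×
                    (∀ v → v ∈ T → cls v ≡ j → v ≡ u)

  Subtransversal : Subset m → Set
  Subtransversal X = ∃ λ T → Transversal T × X ⊆ T

  ExactlyOneSkewPair : Subset m → Set
  ExactlyOneSkewPair X = ∃ λ u → ∃ λ v →
    u ≢ v × cls u ≡ cls v × u ∈ X × v ∈ X ×
    (∀ u' v' → u' ≢ v' → cls u' ≡ cls v' → u' ∈ X → v' ∈ X →
       (u' ≡ u × v' ≡ v) ⊎ (u' ≡ v × v' ≡ u))

  IsSemiMultimatroid : (Subset m → Set) → Set
  IsSemiMultimatroid 𝒞 =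
    (∀ C → 𝒞 C → Subtransversal C) ×
    (∀ T → Transversal T → IsMatroidOn T (λ X → 𝒞 X × X ⊆ T))

  IsMultimatroid : (Subset m → Set) → Set
  IsMultimatroid 𝒞 = IsSemiMultimatroid 𝒞 ×
    (∀ C D → 𝒞 C → 𝒞 D → ¬ ExactlyOneSkewPair (C ∪ D))

  classSize : Fin p → ℕ
  classSize j = ∣ tabulate (λ u → ⌊ cls u ≟ j ⌋) ∣

  IsKMatroid : ℕ → (Subset m → Set) → Set
  IsKMatroid k 𝒞 = IsMultimatroid 𝒞 × (∀ j → classSize j ≡ k)

-- U = Fin (k * n); the element u corresponds to (e , i) where
-- remQuot n u = (i , e), i.e. φ_i(e) = combine i e.  Ω = {ω_e}, with
-- ω_e = {(e , i) : i}, so the skew class of u is its E-component.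

freeCls : ∀ {k n} → Fin (k * n) → Fin n
freeCls {k} {n} u = proj₂ (remQuot {k} n u)

rename : ∀ {k n} → Fin k → Subset n → Subset (k * n)
rename {k} {n} i C = tabulate λ u →
  let (j , e) = remQuot {k} n u in ⌊ j ≟ i ⌋ ∧ Data.Vec.lookup C e
  where import Data.Vec

directSumCircuit : ∀ {k n} → (Fin k → Matroid n) → Subset (k * n) → Set
directSumCircuit σ X = ∃ λ i → ∃ λ C → circuit (σ i) C × X ≡ rename i C

-- circuits of the free sum: the subtransversals X such that X is a circuit
-- of the restriction of the direct sum to some (equivalently any)
-- transversal containing X, i.e. subtransversals that are circuits of the
-- direct sum.
freeSumCircuit : ∀ {k n} → (Fin k → Matroid n) → Subset (k * n) → Set
freeSumCircuit {k} {n} σ X =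
  Carrier.Subtransversal (freeCls {k} {n}) X × directSumCircuit σ X

-- Write every u of U = Fin (k * n) as u = φ_i(e) with "layer" i and
-- "point" e = freeCls u.  A circuit of the free sum is a renamed circuit
-- φ_i(C) of one M_i, and such sets always lie in the transversal φ_i(E).

module Submission where

open import Defs
open import Data.Nat using (ℕ)
open import Data.Fin using (Fin)
open import Data.Product using (_×_)
open import Function.Bundles using (_⇔_)

open import Data.Nat as ℕ using (zero; suc; _+_; _*_)
open import Data.Nat.Properties using (suc-injective; *-identityʳ)
open import Data.Fin as Fin using (remQuot; combine; _↑ˡ_; _↑ʳ_)
open import Data.Fin.Properties using (remQuot-combine; combine-remQuot; splitAt-↑ˡ; splitAt-↑ʳ)
open import Data.Fin.Subset using (Subset; _∈_; _∉_; _⊆_; _∪_; _∩_; _-_; _─_; ∣_∣; ⊥; ⊤; ⁅_⁆; inside; outside)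
open import Data.Fin.Subset.Properties
open import Data.Vec using (_∷_; tabulate; lookup; here; there)
open import Data.Vec.Properties using (lookup∘tabulate; []=⇒lookup; lookup⇒[]=; tabulate-cong)
open import Data.Bool using (Bool; true; false; _∧_)
open import Data.Product using (∃; _,_; proj₁; proj₂; swap)
open import Data.Sum as Sum using (_⊎_; inj₁; inj₂; [_,_]′)
open import Data.Empty using (⊥-elim)
open import Function using (_∘_)
open import Relation.Nullary using (¬_; Dec; yes; no)
open import Relation.Nullary.Decidable using (⌊_⌋)
open import Relation.Binary.PropositionalEquality
open import Function.Bundles using (mk⇔)
open IsMatroidOn

∈-tabulate⁻ : ∀ {m} {f : Fin m → Bool} {x} → x ∈ tabulate f → f x ≡ true
∈-tabulate⁻ {f = f} {x} h = trans (sym (lookup∘tabulate f x)) ([]=⇒lookup h)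

∈-tabulate⁺ : ∀ {m} {f : Fin m → Bool} {x} → f x ≡ true → x ∈ tabulate f
∈-tabulate⁺ {f = f} {x} fx = lookup⇒[]= x _ (trans (lookup∘tabulate f x) fx)

∈─⇒∉ : ∀ {m} (p q : Subset m) {x} → x ∈ p ─ q → x ∉ q
∈─⇒∉ (inside ∷ p) (outside ∷ q) here ()
∈─⇒∉ (b ∷ p) (c ∷ q) (there x∈) (there y) = ∈─⇒∉ p q x∈ y
∈─⇒∉ (outside ∷ p) (c ∷ q) () here

∈-⁻ : ∀ {m} {p : Subset m} {x y} → x ∈ p - y → x ∈ p × x ≢ y
∈-⁻ {p = p} {y = y} h = p─q⊆p p ⁅ y ⁆ h , x∉⁅y⁆⇒x≢y (∈─⇒∉ p ⁅ y ⁆ h)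

∪-least : ∀ {m} {p q r : Subset m} → p ⊆ r → q ⊆ r → p ∪ q ⊆ r
∪-least {p = p} {q} p⊆r q⊆r h = [ p⊆r , q⊆r ]′ (x∈p∪q⁻ p q h)

∣p∣≡0⇒x∉p : ∀ {m} (p : Subset m) → ∣ p ∣ ≡ 0 → ∀ {x} → x ∉ p
∣p∣≡0⇒x∉p (inside ∷ p) () h
∣p∣≡0⇒x∉p (outside ∷ p) eq (there h) = ∣p∣≡0⇒x∉p p eq h

∣p∣≡1⇒singleton : ∀ {m} (p : Subset m) → ∣ p ∣ ≡ 1 →
                  ∃ λ e → e ∈ p × (∀ x → x ∈ p → x ≡ e)
∣p∣≡1⇒singleton (inside ∷ p) eq = Fin.zero , here , only-zero
  where
  only-zero : ∀ x → x ∈ inside ∷ p → x ≡ Fin.zero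
  only-zero Fin.zero    _         = refl
  only-zero (Fin.suc x) (there h) = ⊥-elim (∣p∣≡0⇒x∉p p (suc-injective eq) h)
∣p∣≡1⇒singleton (outside ∷ p) eq with ∣p∣≡1⇒singleton p eq
... | e , e∈p , unique = Fin.suc e , there e∈p , λ { (Fin.suc x) (there h) → cong Fin.suc (unique x h) }

∣⁅j⁆-tabulated∣≡1 : ∀ {m} (j : Fin m) → ∣ tabulate (λ e → ⌊ e Fin.≟ j ⌋) ∣ ≡ 1
∣⁅j⁆-tabulated∣≡1 j = trans (cong ∣_∣ tabulated≡⁅j⁆) (∣⁅x⁆∣≡1 j)
  where
  tabulated≡⁅j⁆ : tabulate (λ e → ⌊ e Fin.≟ j ⌋) ≡ ⁅ j ⁆
  tabulated≡⁅j⁆ = ⊆-antisym to from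
    where
    to : tabulate (λ e → ⌊ e Fin.≟ j ⌋) ⊆ ⁅ j ⁆
    to {x} h with x Fin.≟ j | ∈-tabulate⁻ {f = λ e → ⌊ e Fin.≟ j ⌋} h
    ... | yes refl | _ = x∈⁅x⁆ j
    ... | no _     | ()
    from : ⁅ j ⁆ ⊆ tabulate (λ e → ⌊ e Fin.≟ j ⌋)
    from {x} h = ∈-tabulate⁺ {f = λ e → ⌊ e Fin.≟ j ⌋} {x} (x≡j⇒true (x Fin.≟ j))
      where
      x≡j⇒true : (x≟j : Dec (x ≡ j)) → ⌊ x≟j ⌋ ≡ true
      x≡j⇒true (yes _)  = refl
      x≡j⇒true (no x≢j) = ⊥-elim (x≢j (x∈⁅y⁆⇒x≡y j h))

∣tabulate∣-split : ∀ m m' (f : Fin (m + m') → Bool) →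
  ∣ tabulate f ∣ ≡ ∣ tabulate (f ∘ (_↑ˡ m')) ∣ + ∣ tabulate (f ∘ (m ↑ʳ_)) ∣
∣tabulate∣-split zero    m' f = refl
∣tabulate∣-split (suc m) m' f with f Fin.zero
... | true  = cong suc (∣tabulate∣-split m m' (f ∘ Fin.suc))
... | false = ∣tabulate∣-split m m' (f ∘ Fin.suc)

freeCls-↑ˡ : ∀ k n (e : Fin n) → freeCls {suc k} {n} (e ↑ˡ (k * n)) ≡ e
freeCls-↑ˡ k n e rewrite splitAt-↑ˡ n e (k * n) = refl

freeCls-↑ʳ : ∀ k n (v : Fin (k * n)) → freeCls {suc k} {n} (n ↑ʳ v) ≡ freeCls {k} {n} v
freeCls-↑ʳ k n v rewrite splitAt-↑ʳ n (k * n) v = refl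

∣pullback∣ : ∀ k n (f : Fin n → Bool) →
  ∣ tabulate (f ∘ freeCls {k} {n}) ∣ ≡ k * ∣ tabulate f ∣
∣pullback∣ zero    n f = refl
∣pullback∣ (suc k) n f = begin
    ∣ tabulate (f ∘ freeCls {suc k} {n}) ∣
  ≡⟨ ∣tabulate∣-split n (k * n) (f ∘ freeCls {suc k} {n}) ⟩
    ∣ tabulate (λ e → f (freeCls {suc k} {n} (e ↑ˡ (k * n)))) ∣
      + ∣ tabulate (λ v → f (freeCls {suc k} {n} (n ↑ʳ v))) ∣
  ≡⟨ cong₂ _+_ (cong ∣_∣ (tabulate-cong (cong f ∘ freeCls-↑ˡ k n)))
               (cong ∣_∣ (tabulate-cong (cong f ∘ freeCls-↑ʳ k n))) ⟩
    ∣ tabulate f ∣ + ∣ tabulate (f ∘ freeCls {k} {n}) ∣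
  ≡⟨ cong (∣ tabulate f ∣ +_) (∣pullback∣ k n f) ⟩
    ∣ tabulate f ∣ + k * ∣ tabulate f ∣
  ∎
  where open ≡-Reasoning

freeClassSize : ∀ k n (j : Fin n) → Carrier.classSize (freeCls {k} {n}) j ≡ k
freeClassSize k n j = begin
    ∣ tabulate ((λ e → ⌊ e Fin.≟ j ⌋) ∘ freeCls {k} {n}) ∣
  ≡⟨ ∣pullback∣ k n (λ e → ⌊ e Fin.≟ j ⌋) ⟩
    k * ∣ tabulate (λ e → ⌊ e Fin.≟ j ⌋) ∣
  ≡⟨ cong (k *_) (∣⁅j⁆-tabulated∣≡1 j) ⟩
    k * 1
  ≡⟨ *-identityʳ k ⟩
    k
  ∎
  where open ≡-Reasoning

-- Coordinates on U = Fin (k * n): u = φ_(layer u)(point u).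

module Coordinates (k n : ℕ) where

  layer : Fin (k * n) → Fin k
  layer u = proj₁ (remQuot {k} n u)

  point : Fin (k * n) → Fin n
  point = freeCls {k} {n}

  layer-combine : ∀ (i : Fin k) (e : Fin n) → layer (combine i e) ≡ i
  layer-combine i e = cong proj₁ (remQuot-combine {k} {n} i e)

  point-combine : ∀ (i : Fin k) (e : Fin n) → point (combine i e) ≡ e
  point-combine i e = cong proj₂ (remQuot-combine {k} {n} i e)

  ≡combine : ∀ {u i} {e : Fin n} → layer u ≡ i → point u ≡ e → u ≡ combine i e
  ≡combine {u} refl refl = sym (combine-remQuot {k} n u)

  coordinates-injective : ∀ {u v} → layer u ≡ layer v → point u ≡ point v → u ≡ v
  coordinates-injective {v = v} l p = trans (≡combine l p) (sym (≡combine {v} refl refl))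

  combine-layers-differ : ∀ {i j : Fin k} (e : Fin n) → i ≢ j → combine i e ≢ combine j e
  combine-layers-differ {i} {j} e i≢j eq =
    i≢j (trans (sym (layer-combine i e)) (trans (cong layer eq) (layer-combine j e)))

  ∈rename⁻ : ∀ {i : Fin k} {C : Subset n} {u} → u ∈ rename i C → layer u ≡ i × point u ∈ C
  ∈rename⁻ {i} {C} {u} h with layer u Fin.≟ i | ∈-tabulate⁻ {f = λ v → ⌊ layer v Fin.≟ i ⌋ ∧ lookup C (point v)} h
  ... | yes l | eq = l , lookup⇒[]= (point u) C eq
  ... | no _  | ()

  ∈rename⁺ : ∀ {i : Fin k} {C : Subset n} {u} → layer u ≡ i → point u ∈ C → u ∈ rename i C
  ∈rename⁺ {i} {C} {u} l c = ∈-tabulate⁺ {f = λ v → ⌊ layer v Fin.≟ i ⌋ ∧ lookup C (point v)} holds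
    where
    holds : ⌊ layer u Fin.≟ i ⌋ ∧ lookup C (point u) ≡ true
    holds with layer u Fin.≟ i
    ... | yes _ = []=⇒lookup c
    ... | no ¬l = ⊥-elim (¬l l)

  combine∈rename : ∀ {i : Fin k} {C : Subset n} {e} → e ∈ C → combine i e ∈ rename i C
  combine∈rename {i} {C} {e} h =
    ∈rename⁺ (layer-combine i e) (subst (_∈ C) (sym (point-combine i e)) h)

  rename-⊆⁻ : ∀ {i : Fin k} {C D : Subset n} → rename i C ⊆ rename i D → C ⊆ D
  rename-⊆⁻ {i} {C} {D} sub {x} h =
    subst (_∈ D) (point-combine i x) (proj₂ (∈rename⁻ {i} {D} (sub (combine∈rename {i} h))))

  rename-⊆-layer : ∀ {i j : Fin k} {C D : Subset n} {e} → e ∈ C → rename i C ⊆ rename j D → i ≡ j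
  rename-⊆-layer {i} {j} {C} {D} {e} e∈C sub =
    trans (sym (layer-combine i e)) (proj₁ (∈rename⁻ {j} {D} (sub (combine∈rename {i} e∈C))))

  rename-⊆-minus : ∀ {i : Fin k} {C D F : Subset n} {u} → F ⊆ (C ∪ D) - point u →
                   rename i F ⊆ (rename i C ∪ rename i D) - u
  rename-⊆-minus {i} {C} {D} {F} {u} F⊆ {v} v∈ with ∈rename⁻ {i} {F} v∈
  ... | lv , pv∈F with ∈-⁻ (F⊆ pv∈F)
  ... | pv∈C∪D , pv≢pu = x∈p∧x≢y⇒x∈p-y v∈union (λ v≡u → pv≢pu (cong point v≡u))
    where
    v∈union : v ∈ rename i C ∪ rename i D
    v∈union = x∈p∪q⁺ (Sum.map (∈rename⁺ lv) (∈rename⁺ lv) (x∈p∪q⁻ C D pv∈C∪D))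

  open Carrier (freeCls {k} {n}) using (Transversal; Subtransversal; ExactlyOneSkewPair)

  layer-transversal : ∀ i → Transversal (rename i ⊤)
  layer-transversal i e =
    combine i e , combine∈rename {i} ∈⊤ , point-combine i e ,
    λ v v∈ pv → ≡combine (proj₁ (∈rename⁻ {i} {⊤} v∈)) pv

  rename-subtransversal : ∀ i X → Subtransversal (rename i X)
  rename-subtransversal i X =
    rename i ⊤ , layer-transversal i , λ h → ∈rename⁺ (proj₁ (∈rename⁻ {i} {X} h)) ∈⊤

  same-layer-same-class : ∀ {l : Fin k} {X Y : Subset n} {u v} → u ∈ rename l X → v ∈ rename l Y →
                          point u ≡ point v → u ≡ v
  same-layer-same-class {l} {X} {Y} a b =
    coordinates-injective (trans (proj₁ (∈rename⁻ {l} {X} a)) (sym (proj₁ (∈rename⁻ {l} {Y} b))))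

  -- Two distinct elements of φ_i(C) ∪ φ_j(D) in the same skew class come
  -- one from each of the two renamed sets, which lie in different layers.
  skewPair-in-union : ∀ {i j : Fin k} {C D : Subset n} {u v} → u ≢ v → point u ≡ point v →
    u ∈ rename i C ∪ rename j D → v ∈ rename i C ∪ rename j D →
    i ≢ j × ((u ∈ rename i C × v ∈ rename j D) ⊎ (u ∈ rename j D × v ∈ rename i C))
  skewPair-in-union {i} {j} {C} {D} {u} {v} u≢v puv u∈ v∈
    with x∈p∪q⁻ (rename i C) (rename j D) u∈ | x∈p∪q⁻ (rename i C) (rename j D) v∈
  ... | inj₁ a | inj₁ b = ⊥-elim (u≢v (same-layer-same-class {i} {C} {C} a b puv))
  ... | inj₂ a | inj₂ b = ⊥-elim (u≢v (same-layer-same-class {j} {D} {D} a b puv))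
  ... | inj₁ a | inj₂ b =
    (λ { refl → u≢v (same-layer-same-class {i} {C} {D} a b puv) }) , inj₁ (a , b)
  ... | inj₂ a | inj₁ b =
    (λ { refl → u≢v (same-layer-same-class {i} {D} {C} a b puv) }) , inj₂ (a , b)

  -- If φ_i(C) ∪ φ_j(D) has exactly one skew pair {u , v}, then i ≢ j and
  -- C ∩ D = {point u}: every x ∈ C ∩ D gives the skew pair {φ_i(x), φ_j(x)}.
  exactlyOneSkewPair⇒ : ∀ {i j : Fin k} {C D : Subset n} →
    ExactlyOneSkewPair (rename i C ∪ rename j D) → i ≢ j × ∣ C ∩ D ∣ ≡ 1
  exactlyOneSkewPair⇒ {i} {j} {C} {D} (u , v , u≢v , puv , u∈ , v∈ , unique)
    with skewPair-in-union {i} {j} {C} {D} u≢v puv u∈ v∈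
  ... | i≢j , sides = i≢j , trans (cong ∣_∣ C∩D≡⁅pu⁆) (∣⁅x⁆∣≡1 (point u))
    where
    pu∈C∩D : point u ∈ C ∩ D
    pu∈C∩D = shared-point sides
      where
      shared-point : (u ∈ rename i C × v ∈ rename j D) ⊎ (u ∈ rename j D × v ∈ rename i C) →
                     point u ∈ C ∩ D
      shared-point (inj₁ (a , b)) = x∈p∩q⁺ (proj₂ (∈rename⁻ {i} {C} a) ,
                                            subst (_∈ D) (sym puv) (proj₂ (∈rename⁻ {j} {D} b)))
      shared-point (inj₂ (a , b)) = x∈p∩q⁺ (subst (_∈ C) (sym puv) (proj₂ (∈rename⁻ {i} {C} b)) ,
                                            proj₂ (∈rename⁻ {j} {D} a))
    common⇒pu : ∀ {x} → x ∈ C ∩ D → x ≡ point u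
    common⇒pu {x} h with x∈p∩q⁻ C D h
    ... | x∈C , x∈D
      with unique (combine i x) (combine j x) (combine-layers-differ x i≢j)
                  (trans (point-combine i x) (sym (point-combine j x)))
                  (x∈p∪q⁺ (inj₁ (combine∈rename {i} x∈C)))
                  (x∈p∪q⁺ (inj₂ (combine∈rename {j} x∈D)))
    ... | inj₁ (eq , _) = trans (sym (point-combine i x)) (cong point eq)
    ... | inj₂ (eq , _) = trans (sym (point-combine i x)) (trans (cong point eq) (sym puv))
    C∩D≡⁅pu⁆ : C ∩ D ≡ ⁅ point u ⁆
    C∩D≡⁅pu⁆ = ⊆-antisym
      (λ h → subst (_∈ ⁅ point u ⁆) (sym (common⇒pu h)) (x∈⁅x⁆ (point u)))
      (λ h → subst (_∈ C ∩ D) (sym (x∈⁅y⁆⇒x≡y (point u) h)) pu∈C∩D)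

  -- Conversely, if i ≢ j and C ∩ D = {e}, then {φ_i(e), φ_j(e)} is the
  -- only skew pair of φ_i(C) ∪ φ_j(D).
  exactlyOneSkewPair⇐ : ∀ {i j : Fin k} {C D : Subset n} →
    i ≢ j → ∣ C ∩ D ∣ ≡ 1 → ExactlyOneSkewPair (rename i C ∪ rename j D)
  exactlyOneSkewPair⇐ {i} {j} {C} {D} i≢j size with ∣p∣≡1⇒singleton (C ∩ D) size
  ... | e , e∈C∩D , only-e =
    combine i e , combine j e , combine-layers-differ e i≢j ,
    trans (point-combine i e) (sym (point-combine j e)) ,
    x∈p∪q⁺ (inj₁ (combine∈rename {i} (proj₁ (x∈p∩q⁻ C D e∈C∩D)))) ,
    x∈p∪q⁺ (inj₂ (combine∈rename {j} (proj₂ (x∈p∩q⁻ C D e∈C∩D)))) ,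
    only-pair
    where
    pair-at-e : ∀ {u v} → point u ≡ point v → u ∈ rename i C → v ∈ rename j D →
                u ≡ combine i e × v ≡ combine j e
    pair-at-e {u} {v} puv a b =
      ≡combine (proj₁ (∈rename⁻ {i} {C} a)) pu≡e , ≡combine (proj₁ (∈rename⁻ {j} {D} b)) (trans (sym puv) pu≡e)
      where
      pu≡e : point u ≡ e
      pu≡e = only-e (point u) (x∈p∩q⁺ (proj₂ (∈rename⁻ {i} {C} a) ,
                                      subst (_∈ D) (sym puv) (proj₂ (∈rename⁻ {j} {D} b))))
    only-pair : ∀ u v → u ≢ v → point u ≡ point v →
      u ∈ rename i C ∪ rename j D → v ∈ rename i C ∪ rename j D →
      (u ≡ combine i e × v ≡ combine j e) ⊎ (u ≡ combine j e × v ≡ combine i e)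
    only-pair u v u≢v puv u∈ v∈ with skewPair-in-union {i} {j} {C} {D} u≢v puv u∈ v∈
    ... | _ , inj₁ (a , b) = inj₁ (pair-at-e puv a b)
    ... | _ , inj₂ (a , b) = inj₂ (swap (pair-at-e (sym puv) b a))

module FreeSum (n k : ℕ) (σ : Fin k → Matroid n) where
  open Coordinates k n
  open Carrier (freeCls {k} {n}) using (IsSemiMultimatroid; IsMultimatroid; ExactlyOneSkewPair)

  renamed-circuit : ∀ i C → circuit (σ i) C → freeSumCircuit σ (rename i C)
  renamed-circuit i C cC = rename-subtransversal i C , i , C , cC , refl

  circuit-nonempty : ∀ i C → circuit (σ i) C → ∃ λ e → e ∈ C
  circuit-nonempty i C cC with nonempty? C
  ... | yes ne = ne
  ... | no ¬ne = ⊥-elim (C1 (isMatroid (σ i)) (subst (circuit (σ i)) (Empty-unique ¬ne) cC))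

  RestrictedCircuit : Subset (k * n) → Subset (k * n) → Set
  RestrictedCircuit T X = freeSumCircuit σ X × X ⊆ T

  -- They form a matroid on T, for every T: circuits of the free sum are
  -- copies of circuits of a single M_i, and the axioms transfer along φ_i.
  restriction-isMatroid : ∀ T → IsMatroidOn T (RestrictedCircuit T)
  restriction-isMatroid T = record
    { within = λ _ → proj₂ ; C1 = no-empty ; C2 = minimal ; C3 = elimination }
    where
    no-empty : ¬ RestrictedCircuit T ⊥
    no-empty ((_ , i , C , cC , eq) , _) with circuit-nonempty i C cC
    ... | e , e∈C = ∉⊥ (subst (combine i e ∈_) (sym eq) (combine∈rename {i} e∈C))

    minimal : ∀ X Y → RestrictedCircuit T X → RestrictedCircuit T Y → X ⊆ Y → X ≡ Y
    minimal _ _ ((_ , i , C , cC , refl) , _) ((_ , j , D , cD , refl) , _) sub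
      with circuit-nonempty i C cC
    ... | e , e∈C with rename-⊆-layer {i} {j} {C} {D} e∈C sub
    ... | refl = cong (rename i) (C2 (isMatroid (σ i)) C D cC cD (rename-⊆⁻ {i} sub))

    elimination : ∀ X Y u → RestrictedCircuit T X → RestrictedCircuit T Y → X ≢ Y →
                  u ∈ X → u ∈ Y → ∃ λ F → RestrictedCircuit T F × F ⊆ ((X ∪ Y) - u)
    elimination _ _ u ((_ , i , C , cC , refl) , C⊆T) ((_ , j , D , cD , refl) , D⊆T) X≢Y u∈X u∈Y
      with ∈rename⁻ {i} {C} u∈X | ∈rename⁻ {j} {D} u∈Y
    ... | li , pu∈C | lj , pu∈D with trans (sym li) lj
    ... | refl with C3 (isMatroid (σ i)) C D (point u) cC cD (X≢Y ∘ cong (rename i)) pu∈C pu∈D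
    ... | F , cF , F⊆ = rename i F , (renamed-circuit i F cF , F'⊆T) , F'⊆
      where
      F'⊆ : rename i F ⊆ (rename i C ∪ rename i D) - u
      F'⊆ = rename-⊆-minus {i} {C} {D} {F} F⊆
      F'⊆T : rename i F ⊆ T
      F'⊆T = ⊆-trans F'⊆ (⊆-trans (p─q⊆p _ _) (∪-least C⊆T D⊆T))

  semimultimatroid : IsSemiMultimatroid (freeSumCircuit σ)
  semimultimatroid = (λ _ → proj₁) , λ T _ → restriction-isMatroid T

  orthogonal⇒multimatroid : MutuallyOrthogonal σ → IsMultimatroid (freeSumCircuit σ)
  orthogonal⇒multimatroid orth = semimultimatroid , no-single-skewPair
    where
    no-single-skewPair : ∀ X Y → freeSumCircuit σ X → freeSumCircuit σ Y →
                         ¬ ExactlyOneSkewPair (X ∪ Y)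
    no-single-skewPair _ _ (_ , i , C , cC , refl) (_ , j , D , cD , refl) onePair
      with exactlyOneSkewPair⇒ {i} {j} {C} {D} onePair
    ... | i≢j , ∣C∩D∣≡1 = orth i j i≢j C D cC cD ∣C∩D∣≡1

  -- Circuits C, D of M_i, M_j (i ≢ j) meeting in one point would give
  -- circuits φ_i(C), φ_j(D) of the free sum with exactly one skew pair.
  multimatroid⇒orthogonal : IsMultimatroid (freeSumCircuit σ) → MutuallyOrthogonal σ
  multimatroid⇒orthogonal (_ , no-single-skewPair) i j i≢j C D cC cD ∣C∩D∣≡1 =
    no-single-skewPair (rename i C) (rename j D) (renamed-circuit i C cC) (renamed-circuit j D cD)
      (exactlyOneSkewPair⇐ {i} {j} {C} {D} i≢j ∣C∩D∣≡1)

mainTheorem16 : (n k : ℕ) (σ : Fin k → Matroid n) →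
    (Carrier.IsMultimatroid (freeCls {k} {n}) (freeSumCircuit σ) ⇔ MutuallyOrthogonal σ)
    × (Carrier.IsKMatroid (freeCls {k} {n}) k (freeSumCircuit σ) ⇔ MutuallyOrthogonal σ)
mainTheorem16 n k σ =
  mk⇔ multimatroid⇒orthogonal orthogonal⇒multimatroid ,
  mk⇔ (multimatroid⇒orthogonal ∘ proj₁) (λ orth → orthogonal⇒multimatroid orth , freeClassSize k n)
  where open FreeSum n k σ
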